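{- For every odd $k\ge 13$ there is an ascending partition $\mathcal P$ of $n=3k$ of size $k$ with $\mathrm{slack}(\mathcal P)\ge0$ that is not equitable; and for every odd $k\ge 21$ there is an ascending partition $\mathcal P$ of $n=3k-1$ of size $k$ with $\mathrm{slack}(\mathcal P)\ge 0$ that is not equitable.
   Context: $[n]=\{1,\ldots,n\}$ and $s^{n,k}=\frac{n(n+1)}{2k}$ (an integer in the cases considered). An ascending partition of $n$ of size $k$ is a sequence of positive integers $p_1\le\cdots\le p_k$ with $\sum_i p_i=n$. It is equitable if $[n]$ can be partitioned into sets $A_1,\ldots,A_k$ with $|A_i|=p_i$ and all element sums equal. For $j=1,\ldots,k$, $\mathrm{slack}_j(\mathcal P)=\sum_{i=1}^{p_1+\cdots+p_j}(n-i+1)-j\,s^{n,k}$, and $\mathrm{slack}(\mathcal P)=\min_{1\le j\le k-1}\mathrm{slack}_j(\mathcal P)$. -}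

module Defs where

open import Data.Nat using (ℕ; zero; suc; _+_; _*_; _∸_; _≤_; _<_; _/_; NonZero)
open import Data.Integer as ℤ using (ℤ; +_)
open import Data.List using (List; []; _∷_; length; take)
open import Data.Nat.ListAction using (sum)
open import Data.List.Relation.Unary.All using (All)
open import Data.List.Relation.Unary.Linked using (Linked)
open import Data.Fin using (Fin; toℕ; _≟_)
open import Data.Fin.Subset using (Subset)
open import Data.Product using (Σ; ∃; _×_)
open import Relation.Binary.PropositionalEquality using (_≡_)
open import Relation.Nullary using (¬_)
import Data.Fin as Fin

record AscendingPartition (n k : ℕ) : Set where
  field
    parts     : List ℕ
    size      : length parts ≡ k
    positive  : All (λ x → 0 < x) parts
    ascending : Linked _≤_ parts
    total     : sum parts ≡ n
open AscendingPartition public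

-- the i-th part p_{i+1} (0-based index), 0 if out of range
part : List ℕ → ℕ → ℕ
part []       _       = 0
part (x ∷ _)  zero    = x
part (_ ∷ xs) (suc i) = part xs i

-- sum over elements x of Fin n of g x, where x stands for the integer toℕ x + 1 ∈ [n]
ΣFin : (n : ℕ) → (Fin n → ℕ) → ℕ
ΣFin zero    g = 0
ΣFin (suc n) g = g Fin.zero + ΣFin n (λ x → g (Fin.suc x))

[_≡_] : ∀ {k} → Fin k → Fin k → ℕ
[ a ≡ b ] with a ≟ b
... | Relation.Nullary.yes _ = 1
... | Relation.Nullary.no  _ = 0
  where import Relation.Nullary

-- Equitable: [n] can be partitioned into A₁,…,A_k with |A_i| = p_i and all
-- element sums equal.  The partition is given by a block-assignment
-- f : [n] → [k]  (element toℕ x + 1 goes to block f x), A_j = f⁻¹(j).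
Equitable : (n k : ℕ) → AscendingPartition n k → Set
Equitable n k P =
  Σ (Fin n → Fin k) λ f →
    ((j : Fin k) → ΣFin n (λ x → [ f x ≡ j ]) ≡ part (parts P) (toℕ j))
    × ((i j : Fin k) → ΣFin n (λ x → [ f x ≡ i ] * suc (toℕ x))
                     ≡ ΣFin n (λ x → [ f x ≡ j ] * suc (toℕ x)))

-- s^{n,k} = n(n+1)/(2k)  (exact in the cases considered; k = 0 never used)
s : (n k : ℕ) → ℕ
s n zero    = 0
s n (suc k) = (n * suc n) / (2 * suc k)

topSum : ℕ → ℕ → ℕ
topSum n zero    = 0
topSum n (suc m) = topSum n m + (n ∸ m)

slackAt : (n k : ℕ) → AscendingPartition n k → ℕ → ℤ
slackAt n k P j = + topSum n (sum (take j (parts P))) ℤ.- + (j * s n k)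

SlackNonneg : (n k : ℕ) → AscendingPartition n k → Set
SlackNonneg n k P = (j : ℕ) → 1 ≤ j → j ≤ k ∸ 1 → ℤ.0ℤ ℤ.≤ slackAt n k P j

Odd : ℕ → Set
Odd m = ∃ λ t → m ≡ suc (2 * t)

{-# OPTIONS --safe #-}

-- Write n = τ + 2 + w and call the w elements τ + 3, …, n of [n] large. If every block
-- sums to S > 2(τ + 2) + w, a block of size 2 must contain two large elements, and if
-- also S > 3τ + 3, a block of size 3 must contain one, because three distinct elements
-- of [τ + 2] sum to at most 3τ + 3. Hence a partition with a parts 2 and b parts 3 is not
-- equitable once 2a + b > w. The counterexamples are staircases 2^a 3^b 6^c r with a, b,
-- c, r linear in k on each residue class of k mod 4. Their slack is nonnegative: along a
-- run of equal parts the prefix sum grows linearly in j, so slack_j is concave there, and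
-- it suffices to check it at the ends of the runs, where it is a polynomial inequality in k.

module Submission where

open import Defs
open import Data.Fin as Fin using (Fin; toℕ; _≟_)
import Data.Fin.Properties as Finₚ
open import Data.Integer using (+≤+)
open import Data.Integer.Properties using (i≤j⇒0≤j-i)
open import Data.List using (List; []; _∷_; length; map; take; replicate; _++_)
open import Data.List.Properties using (length-++; length-replicate)
open import Data.List.Relation.Unary.All using (All)
open import Data.List.Relation.Unary.All.Properties as All using (replicate⁺)
open import Data.List.Relation.Unary.Linked using (Linked)
open import Data.Nat using (ℕ; zero; suc; _+_; _*_; _∸_; _/_; _≤_; _<_; _≤?_; z≤n; s≤s; NonZero)
open import Data.Nat.DivMod using (m*n/n≡m)
open import Data.Nat.ListAction using (sum)
open import Data.Nat.Properties hiding (_≟_)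
open import Algebra.Properties.Semiring.Sum +-*-semiring
  using (sum-syntax; ∑-comm; ∑-distrib-+; *-distribˡ-sum; sum-cong-≗)
open import Data.Nat.Tactic.RingSolver using (solve-∀; solve)
open import Data.Product using (Σ; ∃; _×_; _,_)
open import Data.Sum using (_⊎_; inj₁; inj₂)
open import Function using (_∘_)
open import Relation.Binary.PropositionalEquality hiding ([_])
open import Relation.Nullary using (¬_; Dec; yes; no; contradiction)

-- Sums over Fin n

ΣFin≡∑ : ∀ n (g : Fin n → ℕ) → ΣFin n g ≡ ∑[ x < n ] g x
ΣFin≡∑ zero    g = refl
ΣFin≡∑ (suc n) g = cong (g Fin.zero +_) (ΣFin≡∑ n (g ∘ Fin.suc))

∑-mono-≤ : ∀ n {g h : Fin n → ℕ} → (∀ x → g x ≤ h x) → ∑[ x < n ] g x ≤ ∑[ x < n ] h x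
∑-mono-≤ zero    g≤h = z≤n
∑-mono-≤ (suc n) g≤h = +-mono-≤ (g≤h Fin.zero) (∑-mono-≤ n (g≤h ∘ Fin.suc))

∑-const : ∀ n c → ∑[ _ < n ] c ≡ n * c
∑-const zero    c = refl
∑-const (suc n) c = cong (c +_) (∑-const n c)

value : ∀ {n} → Fin n → ℕ
value x = suc (toℕ x)

value≤n : ∀ {n} (x : Fin n) → value x ≤ n
value≤n = Finₚ.toℕ<n

∑-value : ∀ n → 2 * ∑[ x < n ] value x ≡ n * suc n
∑-value zero    = refl
∑-value (suc n) = begin
  2 * (1 + ∑[ x < n ] (1 + value x))
    ≡⟨ cong (λ m → 2 * (1 + m)) (∑-distrib-+ {n} (λ _ → 1) value) ⟩
  2 * (1 + (∑[ _ < n ] 1 + Σv))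
    ≡⟨ cong (λ m → 2 * (1 + (m + Σv))) (trans (∑-const n 1) (*-identityʳ n)) ⟩
  2 * (1 + (n + Σv))                   ≡⟨ expand n Σv ⟩
  2 * (1 + n) + 2 * Σv                 ≡⟨ cong (2 * (1 + n) +_) (∑-value n) ⟩
  2 * (1 + n) + n * suc n              ≡⟨ collect n ⟩
  suc n * suc (suc n)                  ∎
  where
  open ≡-Reasoning
  Σv = ∑[ x < n ] value x
  expand : ∀ n s → 2 * (1 + (n + s)) ≡ 2 * (1 + n) + 2 * s
  expand = solve-∀
  collect : ∀ n → 2 * (1 + n) + n * suc n ≡ suc n * suc (suc n)
  collect = solve-∀

[≡]-yes : ∀ {k} {a b : Fin k} → a ≡ b → [ a ≡ b ] ≡ 1
[≡]-yes {a = a} {b} a≡b with a ≟ b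
... | yes _  = refl
... | no a≢b = contradiction a≡b a≢b

[≡]-no : ∀ {k} {a b : Fin k} → a ≢ b → [ a ≡ b ] ≡ 0
[≡]-no {a = a} {b} a≢b with a ≟ b
... | yes a≡b = contradiction a≡b a≢b
... | no _    = refl

[≡]≤1 : ∀ {k} (a b : Fin k) → [ a ≡ b ] ≤ 1
[≡]≤1 a b with a ≟ b
... | yes _ = ≤-refl
... | no _  = z≤n

[≡]-suc : ∀ {k} (a b : Fin k) → [ Fin.suc a ≡ Fin.suc b ] ≡ [ a ≡ b ]
[≡]-suc a b = by-cases (a ≟ b)
  where
  by-cases : Dec (a ≡ b) → [ Fin.suc a ≡ Fin.suc b ] ≡ [ a ≡ b ]
  by-cases (yes a≡b) = trans ([≡]-yes (cong Fin.suc a≡b)) (sym ([≡]-yes a≡b))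
  by-cases (no a≢b)  = trans ([≡]-no (a≢b ∘ Finₚ.suc-injective)) (sym ([≡]-no a≢b))

∑-select : ∀ k (y : Fin k) (g : Fin k → ℕ) → ∑[ j < k ] ([ y ≡ j ] * g j) ≡ g y
∑-select (suc k) Fin.zero g = begin
  [ y ≡ y ] * g y + ∑[ j < k ] ([ y ≡ Fin.suc j ] * g (Fin.suc j))
    ≡⟨ cong₂ _+_ (cong (_* g y) ([≡]-yes {a = y} refl))
                 (sum-cong-≗ (λ j → cong (_* g (Fin.suc j)) ([≡]-no {a = y} {Fin.suc j} λ ()))) ⟩
  1 * g y + ∑[ _ < k ] 0
    ≡⟨ cong₂ _+_ (*-identityˡ (g y)) (trans (∑-const k 0) (*-zeroʳ k)) ⟩
  g y + 0
    ≡⟨ +-identityʳ (g y) ⟩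
  g y ∎
  where
  open ≡-Reasoning
  y = Fin.zero
∑-select (suc k) (Fin.suc y) g = begin
  [ Fin.suc y ≡ Fin.zero ] * g Fin.zero + ∑[ j < k ] ([ Fin.suc y ≡ Fin.suc j ] * g (Fin.suc j))
    ≡⟨ cong₂ _+_ (cong (_* g Fin.zero) ([≡]-no {a = Fin.suc y} {Fin.zero} λ ()))
                 (sum-cong-≗ (λ j → cong (_* g (Fin.suc j)) ([≡]-suc y j))) ⟩
  ∑[ j < k ] ([ y ≡ j ] * g (Fin.suc j))
    ≡⟨ ∑-select k y (g ∘ Fin.suc) ⟩
  g (Fin.suc y) ∎
  where open ≡-Reasoning

∑-fibres : ∀ {n k} (f : Fin n → Fin k) (v : Fin n → ℕ) →
           ∑[ j < k ] ∑[ x < n ] ([ f x ≡ j ] * v x) ≡ ∑[ x < n ] v x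
∑-fibres {k = k} f v =
  trans (∑-comm (λ j x → [ f x ≡ j ] * v x)) (sum-cong-≗ (λ x → ∑-select k (f x) (λ _ → v x)))

-- Thresholds and large elements

[_<_] : ℕ → ℕ → ℕ
[ _     < zero  ] = 0
[ zero  < suc _ ] = 1
[ suc c < suc v ] = [ c < v ]

[<]≤1 : ∀ c v → [ c < v ] ≤ 1
[<]≤1 _       zero    = z≤n
[<]≤1 zero    (suc _) = ≤-refl
[<]≤1 (suc c) (suc v) = [<]≤1 c v

[<]-antitone : ∀ {c d} v → c ≤ d → [ d < v ] ≤ [ c < v ]
[<]-antitone zero    _         = z≤n
[<]-antitone {d = d} (suc v) z≤n = [<]≤1 d (suc v)
[<]-antitone (suc v) (s≤s c≤d) = [<]-antitone v c≤d

∑-[<] : ∀ n c → ∑[ x < n ] [ c < value x ] ≡ n ∸ c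
∑-[<] zero    c       = sym (0∸n≡0 c)
∑-[<] (suc n) zero    = cong suc (∑-[<] n zero)
∑-[<] (suc n) (suc c) = ∑-[<] n c

≤-split-at : ∀ c w v → v ≤ c + w → v ≤ c + w * [ c < v ]
≤-split-at zero    w zero    _         = z≤n
≤-split-at zero    w (suc v) v≤w       = ≤-trans v≤w (≤-reflexive (sym (*-identityʳ w)))
≤-split-at (suc c) w zero    _         = z≤n
≤-split-at (suc c) w (suc v) (s≤s v≤) = s≤s (≤-split-at c w v v≤)

≤-split-at-three : ∀ c w v → v ≤ c + 2 + w →
                   v ≤ c + [ c < v ] + [ suc c < v ] + w * [ c + 2 < v ]
≤-split-at-three zero    w zero                  _         = z≤n
≤-split-at-three zero    w (suc zero)            _         = m≤m+n 1 (w * 0)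
≤-split-at-three zero    w (suc (suc zero))      _         = m≤m+n 2 (w * 0)
≤-split-at-three zero    w (suc (suc (suc v)))   v≤        =
  ≤-trans v≤ (≤-reflexive (cong (2 +_) (sym (*-identityʳ w))))
≤-split-at-three (suc c) w zero                  _         = z≤n
≤-split-at-three (suc c) w (suc v)               (s≤s v≤) = s≤s (≤-split-at-three c w v v≤)

*-+-swap-≤ : ∀ {i a b} → i ≤ 1 → b ≤ a → i * a + b ≤ i * b + a
*-+-swap-≤ {0}             _         b≤a = b≤a
*-+-swap-≤ {1}     {a} {b} _         _   = ≤-reflexive (swap a b)
  where
  swap : ∀ a b → 1 * a + b ≡ 1 * b + a
  swap = solve-∀
*-+-swap-≤ {suc (suc _)}   (s≤s ()) _

∑-linear : ∀ n a b (f g : Fin n → ℕ) →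
           ∑[ x < n ] (a * f x + b * g x) ≡ a * ∑[ x < n ] f x + b * ∑[ x < n ] g x
∑-linear n a b f g = trans (∑-distrib-+ {n} (λ x → a * f x) (λ x → b * g x))
  (sym (cong₂ _+_ (*-distribˡ-sum a f) (*-distribˡ-sum b g)))

largeDemand : ℕ → ℕ
largeDemand 2 = 2
largeDemand 3 = 1
largeDemand _ = 0

∑-part : ∀ (G : ℕ → ℕ) ps → ∑[ j < length ps ] G (part ps (toℕ j)) ≡ sum (map G ps)
∑-part G []       = refl
∑-part G (p ∷ ps) = cong (G p +_) (∑-part G ps)

block-sum≡mean : ∀ {n k S} (f : Fin n → Fin k) → 2 * (k * S) ≡ n * suc n →
  (∀ i j → ∑[ x < n ] ([ f x ≡ i ] * value x) ≡ ∑[ x < n ] ([ f x ≡ j ] * value x)) →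
  ∀ j → ∑[ x < n ] ([ f x ≡ j ] * value x) ≡ S
block-sum≡mean {n} {suc k} {S} f mean balanced j =
  *-cancelˡ-≡ _ S (suc k) (*-cancelˡ-≡ _ (suc k * S) 2 (begin
    2 * (suc k * B j)          ≡⟨ cong (2 *_) (∑-const (suc k) (B j)) ⟨
    2 * ∑[ i < suc k ] B j     ≡⟨ cong (2 *_) (sum-cong-≗ (λ i → balanced i j)) ⟨
    2 * ∑[ i < suc k ] B i     ≡⟨ cong (2 *_) (∑-fibres f value) ⟩
    2 * ∑[ x < n ] value x     ≡⟨ ∑-value n ⟩
    n * suc n                  ≡⟨ mean ⟨
    2 * (suc k * S)            ∎))
  where
  open ≡-Reasoning
  B : Fin (suc k) → ℕ
  B i = ∑[ x < n ] ([ f x ≡ i ] * value x)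

module LargeElements (τ w : ℕ) where

  N : ℕ
  N = τ + 2 + w

  large : Fin N → ℕ
  large x = [ τ + 2 < value x ]

  module _ (I : Fin N → ℕ) (I≤1 : ∀ x → I x ≤ 1) where

    largeCount : ℕ
    largeCount = ∑[ x < N ] (I x * large x)

    weight : ℕ
    weight = ∑[ x < N ] (I x * value x)

    -- An element of I above c is either large or one of the e values c + 1, …, τ + 2.
    count-above-≤ : ∀ c e → c + e ≡ τ + 2 → ∑[ x < N ] (I x * [ c < value x ]) ≤ largeCount + e
    count-above-≤ c e c+e≡ = +-cancelʳ-≤ w _ _ (begin
      ∑[ x < N ] (I x * [ c < value x ]) + w
        ≡⟨ cong (∑[ x < N ] (I x * [ c < value x ]) +_) large-total ⟨
      ∑[ x < N ] (I x * [ c < value x ]) + ∑[ x < N ] large x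
        ≡⟨ ∑-distrib-+ {N} _ _ ⟨
      ∑[ x < N ] (I x * [ c < value x ] + large x)
        ≤⟨ ∑-mono-≤ N (λ x → *-+-swap-≤ (I≤1 x) ([<]-antitone (value x) c≤τ+2)) ⟩
      ∑[ x < N ] (I x * large x + [ c < value x ])
        ≡⟨ ∑-distrib-+ {N} _ _ ⟩
      largeCount + ∑[ x < N ] [ c < value x ]
        ≡⟨ cong (largeCount +_) (trans (∑-[<] N c) above-c) ⟩
      largeCount + (e + w)
        ≡⟨ +-assoc largeCount e w ⟨
      largeCount + e + w ∎)
      where
      open ≤-Reasoning
      large-total : ∑[ x < N ] large x ≡ w
      large-total = trans (∑-[<] N (τ + 2)) (m+n∸m≡n (τ + 2) w)
      c≤τ+2 : c ≤ τ + 2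
      c≤τ+2 = subst (c ≤_) c+e≡ (m≤m+n c e)
      above-c : N ∸ c ≡ e + w
      above-c = begin-equality
        τ + 2 + w ∸ c   ≡⟨ cong (λ t → t + w ∸ c) c+e≡ ⟨
        c + e + w ∸ c   ≡⟨ cong (_∸ c) (+-assoc c e w) ⟩
        c + (e + w) ∸ c ≡⟨ m+n∸m≡n c (e + w) ⟩
        e + w           ∎

    weight-≤-pair : weight ≤ (τ + 2) * ∑[ x < N ] I x + w * largeCount
    weight-≤-pair = begin
      ∑[ x < N ] (I x * value x)
        ≤⟨ ∑-mono-≤ N (λ x → *-monoʳ-≤ (I x) (≤-split-at (τ + 2) w (value x) (value≤n x))) ⟩
      ∑[ x < N ] (I x * (τ + 2 + w * large x))
        ≡⟨ sum-cong-≗ (λ x → distribute w (I x) (τ + 2) (large x)) ⟩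
      ∑[ x < N ] ((τ + 2) * I x + w * (I x * large x))
        ≡⟨ ∑-linear N (τ + 2) w I (λ x → I x * large x) ⟩
      (τ + 2) * ∑[ x < N ] I x + w * largeCount ∎
      where
      open ≤-Reasoning
      distribute : ∀ w i t l → i * (t + w * l) ≡ t * i + w * (i * l)
      distribute = solve-∀

    weight-≤-triple : weight ≤ τ * ∑[ x < N ] I x + (largeCount + 2) + (largeCount + 1) + w * largeCount
    weight-≤-triple = begin
      ∑[ x < N ] (I x * value x)
        ≤⟨ ∑-mono-≤ N (λ x → *-monoʳ-≤ (I x) (≤-split-at-three τ w (value x) (value≤n x))) ⟩
      ∑[ x < N ] (I x * (τ + A x + B x + w * large x))
        ≡⟨ sum-cong-≗ (λ x → distribute τ w (I x) (A x) (B x) (large x)) ⟩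
      ∑[ x < N ] ((τ * I x + 1 * (I x * A x)) + (1 * (I x * B x) + w * (I x * large x)))
        ≡⟨ ∑-distrib-+ {N} _ _ ⟩
      ∑[ x < N ] (τ * I x + 1 * (I x * A x)) + ∑[ x < N ] (1 * (I x * B x) + w * (I x * large x))
        ≡⟨ cong₂ _+_ (∑-linear N τ 1 I (λ x → I x * A x))
                     (∑-linear N 1 w (λ x → I x * B x) (λ x → I x * large x)) ⟩
      (τ * ∑[ x < N ] I x + 1 * ∑[ x < N ] (I x * A x)) + (1 * ∑[ x < N ] (I x * B x) + w * largeCount)
        ≤⟨ +-mono-≤ (+-monoʳ-≤ (τ * _) (*-monoʳ-≤ 1 (count-above-≤ τ 2 refl)))
                    (+-monoˡ-≤ (w * largeCount) (*-monoʳ-≤ 1 (count-above-≤ (suc τ) 1 (sym (+-suc τ 1))))) ⟩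
      (τ * ∑[ x < N ] I x + 1 * (largeCount + 2)) + (1 * (largeCount + 1) + w * largeCount)
        ≡⟨ regroup (τ * ∑[ x < N ] I x) (largeCount + 2) (largeCount + 1) (w * largeCount) ⟩
      τ * ∑[ x < N ] I x + (largeCount + 2) + (largeCount + 1) + w * largeCount ∎
      where
      open ≤-Reasoning
      A B : Fin N → ℕ
      A x = [ τ < value x ]
      B x = [ suc τ < value x ]
      distribute : ∀ τ w i a b l →
                   i * (τ + a + b + w * l) ≡ (τ * i + 1 * (i * a)) + (1 * (i * b) + w * (i * l))
      distribute = solve-∀
      regroup : ∀ p q r s → (p + 1 * q) + (1 * r + s) ≡ p + q + r + s
      regroup = solve-∀

    largeDemand≤largeCount : ∀ p S → ∑[ x < N ] I x ≡ p → weight ≡ S →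
      (τ + 2) * 2 + w < S → τ * 3 + 3 < S → largeDemand p ≤ largeCount
    largeDemand≤largeCount 2 S size≡2 weight≡S pairs-heavy _ with largeCount ≤? 1
    ... | no u≰1  = ≰⇒> u≰1
    ... | yes u≤1 = contradiction (begin
      S                                        ≡⟨ weight≡S ⟨
      weight                                   ≤⟨ weight-≤-pair ⟩
      (τ + 2) * ∑[ x < N ] I x + w * largeCount
        ≤⟨ +-mono-≤ (≤-reflexive (cong ((τ + 2) *_) size≡2)) (*-monoʳ-≤ w u≤1) ⟩
      (τ + 2) * 2 + w * 1                      ≡⟨ cong ((τ + 2) * 2 +_) (*-identityʳ w) ⟩
      (τ + 2) * 2 + w                          ∎) (<⇒≱ pairs-heavy)
      where open ≤-Reasoning
    largeDemand≤largeCount 3 S size≡3 weight≡S _ triples-heavy with largeCount in u≡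
    ... | suc _ = s≤s z≤n
    ... | zero  = contradiction (begin
      S ≡⟨ weight≡S ⟨
      weight ≤⟨ weight-≤-triple ⟩
      τ * ∑[ x < N ] I x + (largeCount + 2) + (largeCount + 1) + w * largeCount
        ≡⟨ cong₂ (λ p u → τ * p + (u + 2) + (u + 1) + w * u) size≡3 u≡ ⟩
      τ * 3 + (0 + 2) + (0 + 1) + w * 0 ≡⟨ no-large τ w ⟩
      τ * 3 + 3 ∎) (<⇒≱ triples-heavy)
      where
      open ≤-Reasoning
      no-large : ∀ τ w → τ * 3 + (0 + 2) + (0 + 1) + w * 0 ≡ τ * 3 + 3
      no-large = solve-∀
    largeDemand≤largeCount 0                         _ _ _ _ _ = z≤n
    largeDemand≤largeCount 1                         _ _ _ _ _ = z≤n
    largeDemand≤largeCount (suc (suc (suc (suc _)))) _ _ _ _ _ = z≤n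

  not-equitable : ∀ {n k S} → n ≡ N → (P : AscendingPartition n k) → 2 * (k * S) ≡ n * suc n →
    (τ + 2) * 2 + w < S → τ * 3 + 3 < S → w < sum (map largeDemand (parts P)) →
    ¬ Equitable n k P
  not-equitable {k = k} {S} refl P mean pairs-heavy triples-heavy demand (f , sizes , balanced) =
    <⇒≱ demand (begin
      sum (map largeDemand (parts P))                  ≡⟨ ∑-part largeDemand (parts P) ⟨
      ∑[ j < length (parts P) ] largeDemand (part (parts P) (toℕ j))
        ≡⟨ cong (λ m → ∑[ j < m ] largeDemand (part (parts P) (toℕ j))) (size P) ⟩
      ∑[ j < k ] largeDemand (part (parts P) (toℕ j))  ≤⟨ ∑-mono-≤ k demand≤count ⟩
      ∑[ j < k ] largeCount (block j) (block≤1 j)      ≡⟨ ∑-fibres f large ⟩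
      ∑[ x < N ] large x                               ≡⟨ ∑-[<] N (τ + 2) ⟩
      N ∸ (τ + 2)                                      ≡⟨ m+n∸m≡n (τ + 2) w ⟩
      w                                                ∎)
    where
    open ≤-Reasoning
    block : Fin k → Fin N → ℕ
    block j x = [ f x ≡ j ]
    block≤1 : ∀ j x → block j x ≤ 1
    block≤1 j x = [≡]≤1 (f x) j
    block-size : ∀ j → ∑[ x < N ] block j x ≡ part (parts P) (toℕ j)
    block-size j = trans (sym (ΣFin≡∑ N (block j))) (sizes j)
    block-sum : ∀ j → weight (block j) (block≤1 j) ≡ S
    block-sum = block-sum≡mean f mean λ i j →
      trans (sym (ΣFin≡∑ N _)) (trans (balanced i j) (ΣFin≡∑ N _))
    demand≤count : ∀ j → largeDemand (part (parts P) (toℕ j)) ≤ largeCount (block j) (block≤1 j)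
    demand≤count j = largeDemand≤largeCount (block j) (block≤1 j) _ S
      (block-size j) (block-sum j) pairs-heavy triples-heavy

-- Slack through prefix sums

topSum-closed : ∀ n M → M ≤ n → 2 * topSum n M + M * M ≡ M * (2 * n + 1)
topSum-closed n zero    _     = refl
topSum-closed n (suc M) 1+M≤n = begin
  2 * (topSum n M + d) + suc M * suc M   ≡⟨ split (topSum n M) M d ⟩
  (2 * topSum n M + M * M) + (2 * d + 2 * M + 1)
    ≡⟨ cong (_+ (2 * d + 2 * M + 1)) (topSum-closed n M M≤n) ⟩
  M * (2 * n + 1) + (2 * d + 2 * M + 1) ≡⟨ cong (λ m → M * (2 * m + 1) + (2 * d + 2 * M + 1)) M+d≡n ⟨
  M * (2 * (M + d) + 1) + (2 * d + 2 * M + 1) ≡⟨ merge M d ⟩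
  suc M * (2 * (M + d) + 1)             ≡⟨ cong (λ m → suc M * (2 * m + 1)) M+d≡n ⟩
  suc M * (2 * n + 1)                   ∎
  where
  open ≡-Reasoning
  d = n ∸ M
  M≤n = ≤-trans (n≤1+n M) 1+M≤n
  M+d≡n : M + d ≡ n
  M+d≡n = m+[n∸m]≡n M≤n
  split : ∀ T M d → 2 * (T + d) + suc M * suc M ≡ (2 * T + M * M) + (2 * d + 2 * M + 1)
  split = solve-∀
  merge : ∀ M d → M * (2 * (M + d) + 1) + (2 * d + 2 * M + 1) ≡ suc M * (2 * (M + d) + 1)
  merge = solve-∀

-- j S ≤ topSum n M, doubled and rewritten with topSum-closed so that no subtraction occurs.
Fits : (n S j M : ℕ) → Set
Fits n S j M = 2 * j * S + M * M ≤ M * (2 * n + 1)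

Fits⇒≤topSum : ∀ {n S j M} → M ≤ n → Fits n S j M → j * S ≤ topSum n M
Fits⇒≤topSum {n} {S} {j} {M} M≤n fits = *-cancelˡ-≤ 2 (+-cancelʳ-≤ (M * M) _ _ (begin
  2 * (j * S) + M * M    ≡⟨ cong (_+ M * M) (*-assoc 2 j S) ⟨
  2 * j * S + M * M      ≤⟨ fits ⟩
  M * (2 * n + 1)        ≡⟨ topSum-closed n M M≤n ⟨
  2 * topSum n M + M * M ∎))
  where open ≤-Reasoning

fits-total : ∀ {n k S} → 2 * (k * S) ≡ n * suc n → Fits n S k n
fits-total {n} {k} {S} mean = ≤-reflexive (begin
  2 * k * S + n * n   ≡⟨ cong (_+ n * n) (*-assoc 2 k S) ⟩
  2 * (k * S) + n * n ≡⟨ cong (_+ n * n) mean ⟩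
  n * suc n + n * n   ≡⟨ collect n ⟩
  n * (2 * n + 1)     ∎)
  where
  open ≡-Reasoning
  collect : ∀ n → n * suc n + n * n ≡ n * (2 * n + 1)
  collect = solve-∀

fits-interpolate : ∀ {n S j M} q i e .{{_ : NonZero (i + e)}} →
  Fits n S j M → Fits n S (j + (i + e)) (M + (i + e) * q) → Fits n S (j + i) (M + i * q)
fits-interpolate {n} {S} {j} {M} q i e fits₀ fits₁ = *-cancelˡ-≤ (i + e) (begin
  (i + e) * A i                          ≤⟨ m≤m+n _ _ ⟩
  (i + e) * A i + q * q * (i + e) * i * e ≡⟨ convexity S j M q i e ⟩
  e * A 0 + i * A (i + e)                ≤⟨ +-mono-≤ (*-monoʳ-≤ e fits₀′) (*-monoʳ-≤ i fits₁) ⟩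
  e * B 0 + i * B (i + e)                ≡⟨ linearity n M q i e ⟩
  (i + e) * B i                          ∎)
  where
  open ≤-Reasoning
  -- A is quadratic in x with leading coefficient q², B is linear in x.
  A B : ℕ → ℕ
  A x = 2 * (j + x) * S + (M + x * q) * (M + x * q)
  B x = (M + x * q) * (2 * n + 1)
  fits₀′ : A 0 ≤ B 0
  fits₀′ = subst₂ (Fits n S) (sym (+-identityʳ j)) (sym (+-identityʳ M)) fits₀
  convexity : ∀ S j M q i e →
    (i + e) * (2 * (j + i) * S + (M + i * q) * (M + i * q)) + q * q * (i + e) * i * e
    ≡ e * (2 * (j + 0) * S + (M + 0 * q) * (M + 0 * q))
      + i * (2 * (j + (i + e)) * S + (M + (i + e) * q) * (M + (i + e) * q))
  convexity = solve-∀
  linearity : ∀ n M q i e →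
    e * ((M + 0 * q) * (2 * n + 1)) + i * ((M + (i + e) * q) * (2 * n + 1))
    ≡ (i + e) * ((M + i * q) * (2 * n + 1))
  linearity = solve-∀

fits-between : ∀ {n S j M} q i e →
  Fits n S j M → Fits n S (j + (i + e)) (M + (i + e) * q) → Fits n S (j + i) (M + i * q)
fits-between                 q zero    zero    _     fits₁ = fits₁
fits-between {n} {S} {j} {M} q (suc i) e       fits₀ fits₁ =
  fits-interpolate {n} {S} {j} {M} q (suc i) e fits₀ fits₁
fits-between {n} {S} {j} {M} q zero    (suc e) fits₀ fits₁ =
  fits-interpolate {n} {S} {j} {M} q zero (suc e) fits₀ fits₁

sum-take-replicate : ∀ L q ys {i} → i ≤ L → sum (take i (replicate L q ++ ys)) ≡ i * q
sum-take-replicate L       q ys {zero}  _         = refl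
sum-take-replicate (suc L) q ys {suc i} (s≤s i≤L) = cong (q +_) (sum-take-replicate L q ys i≤L)

sum-take-replicate-++ : ∀ L q ys d → sum (take (L + d) (replicate L q ++ ys)) ≡ L * q + sum (take d ys)
sum-take-replicate-++ zero    q ys d = refl
sum-take-replicate-++ (suc L) q ys d =
  trans (cong (q +_) (sum-take-replicate-++ L q ys d)) (sym (+-assoc q (L * q) _))

sum-take-≤ : ∀ i xs → sum (take i xs) ≤ sum xs
sum-take-≤ zero    xs       = z≤n
sum-take-≤ (suc i) []       = z≤n
sum-take-≤ (suc i) (x ∷ xs) = +-monoʳ-≤ x (sum-take-≤ i xs)

record PrefixesFit (n S j M : ℕ) (xs : List ℕ) : Set where
  constructor prefixesFit
  field
    fits-prefix : ∀ i → i ≤ length xs → Fits n S (j + i) (M + sum (take i xs))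
open PrefixesFit

prefixesFit-[] : ∀ {n S j M} → Fits n S j M → PrefixesFit n S j M []
prefixesFit-[] {n} {S} {j} {M} fits = prefixesFit λ where
  .0 z≤n → subst₂ (Fits n S) (sym (+-identityʳ j)) (sym (+-identityʳ M)) fits

length-replicate-++ : ∀ L (q : ℕ) ys → length (replicate L q ++ ys) ≡ L + length ys
length-replicate-++ L q ys = trans (length-++ (replicate L q)) (cong (_+ length ys) (length-replicate L))

prefixesFit-replicate-++ : ∀ {n S j M} L q ys → Fits n S j M →
  PrefixesFit n S (j + L) (M + L * q) ys → PrefixesFit n S j M (replicate L q ++ ys)
prefixesFit-replicate-++ {n} {S} {j} {M} L q ys fits₀ rest = prefixesFit fits-at
  where
  xs = replicate L q ++ ys

  within-run : ∀ i → i ≤ L → Fits n S (j + i) (M + sum (take i xs))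
  within-run i i≤L rewrite sum-take-replicate L q ys i≤L =
    fits-between {n} {S} {j} {M} q i (L ∸ i) fits₀
      (subst (λ l → Fits n S (j + l) (M + l * q)) (sym (m+[n∸m]≡n i≤L)) end-of-run)
    where
    end-of-run : Fits n S (j + L) (M + L * q)
    end-of-run = subst₂ (Fits n S) (+-identityʳ (j + L)) (+-identityʳ (M + L * q)) (fits-prefix rest 0 z≤n)

  beyond-run : ∀ d → d ≤ length ys → Fits n S (j + (L + d)) (M + sum (take (L + d) xs))
  beyond-run d d≤len rewrite sum-take-replicate-++ L q ys d =
    subst₂ (Fits n S) (+-assoc j L d) (+-assoc M (L * q) _) (fits-prefix rest d d≤len)

  fits-at : ∀ i → i ≤ length xs → Fits n S (j + i) (M + sum (take i xs))
  fits-at i i≤len with i ≤? L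
  ... | yes i≤L = within-run i i≤L
  ... | no  i≰L = subst (λ i → Fits n S (j + i) (M + sum (take i xs))) L+d≡i (beyond-run d d≤len)
    where
    d = i ∸ L
    L+d≡i : L + d ≡ i
    L+d≡i = m+[n∸m]≡n (<⇒≤ (≰⇒> i≰L))
    d≤len : d ≤ length ys
    d≤len = +-cancelˡ-≤ L _ _ (subst₂ _≤_ (sym L+d≡i) (length-replicate-++ L q ys) i≤len)

s-exact : ∀ n k S → 2 * (suc k * S) ≡ n * suc n → s n (suc k) ≡ S
s-exact n k S mean = trans (cong (_/ (2 * suc k)) (sym (trans (reorder S k) mean))) (m*n/n≡m S (2 * suc k))
  where
  reorder : ∀ S k → S * (2 * suc k) ≡ 2 * (suc k * S)
  reorder = solve-∀

slack-nonneg : ∀ {n k S} (P : AscendingPartition n k) → 2 * (k * S) ≡ n * suc n →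
  PrefixesFit n S 0 0 (parts P) → SlackNonneg n k P
slack-nonneg {k = zero} P _ _ j 1≤j j≤0 = contradiction (≤-trans 1≤j j≤0) λ ()
slack-nonneg {n} {suc k} {S} P mean prefixes j _ j≤k = i≤j⇒0≤j-i (+≤+ (begin
  j * s n (suc k) ≡⟨ cong (j *_) (s-exact n k S mean) ⟩
  j * S           ≤⟨ Fits⇒≤topSum {n} {S} {j} M≤n (fits-prefix prefixes j j≤len) ⟩
  topSum n M      ∎))
  where
  open ≤-Reasoning
  M = sum (take j (parts P))
  M≤n : M ≤ n
  M≤n = subst (M ≤_) (total P) (sum-take-≤ j (parts P))
  j≤len : j ≤ length (parts P)
  j≤len = subst (j ≤_) (sym (size P)) (≤-trans j≤k (n≤1+n k))

-- Staircase partitions 2^a 3^b 6^c r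

≤-offset : ∀ {m n} d → m + d ≡ n → m ≤ n
≤-offset {m} d refl = m≤m+n m d

sum-replicate-++ : ∀ a x ys → sum (replicate a x ++ ys) ≡ a * x + sum ys
sum-replicate-++ zero    x ys = refl
sum-replicate-++ (suc a) x ys = trans (cong (x +_) (sum-replicate-++ a x ys)) (sym (+-assoc x (a * x) _))

sum-map-replicate-++ : ∀ (G : ℕ → ℕ) a x ys →
                       sum (map G (replicate a x ++ ys)) ≡ a * G x + sum (map G ys)
sum-map-replicate-++ G zero    x ys = refl
sum-map-replicate-++ G (suc a) x ys =
  trans (cong (G x +_) (sum-map-replicate-++ G a x ys)) (sym (+-assoc (G x) (a * G x) _))

staircase : ℕ → ℕ → ℕ → ℕ → List ℕ
staircase a b c r = replicate a 2 ++ replicate b 3 ++ replicate c 6 ++ r ∷ []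

staircase-length : ∀ a b c r → length (staircase a b c r) ≡ a + b + c + 1
staircase-length a b c r = begin
  length (staircase a b c r) ≡⟨ length-replicate-++ a 2 _ ⟩
  a + length (replicate b 3 ++ replicate c 6 ++ r ∷ [])
    ≡⟨ cong (a +_) (trans (length-replicate-++ b 3 _) (cong (b +_) (length-replicate-++ c 6 _))) ⟩
  a + (b + (c + 1))          ≡⟨ reassociate a b c 1 ⟩
  a + b + c + 1              ∎
  where
  open ≡-Reasoning
  reassociate : ∀ a b c d → a + (b + (c + d)) ≡ a + b + c + d
  reassociate = solve-∀

staircase-sum : ∀ a b c r → sum (staircase a b c r) ≡ a * 2 + b * 3 + c * 6 + r
staircase-sum a b c r = begin
  sum (staircase a b c r)   ≡⟨ sum-replicate-++ a 2 _ ⟩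
  a * 2 + sum (replicate b 3 ++ replicate c 6 ++ r ∷ [])
    ≡⟨ cong (a * 2 +_) (trans (sum-replicate-++ b 3 _) (cong (b * 3 +_) (sum-replicate-++ c 6 _))) ⟩
  a * 2 + (b * 3 + (c * 6 + (r + 0))) ≡⟨ reassociate a b c r ⟩
  a * 2 + b * 3 + c * 6 + r ∎
  where
  open ≡-Reasoning
  reassociate : ∀ a b c r → a * 2 + (b * 3 + (c * 6 + (r + 0))) ≡ a * 2 + b * 3 + c * 6 + r
  reassociate = solve-∀

staircase-largeDemand : ∀ a b c r → 6 ≤ r → sum (map largeDemand (staircase a b c r)) ≡ a * 2 + b
staircase-largeDemand a b c r (s≤s (s≤s (s≤s (s≤s _)))) = begin
  sum (map largeDemand (staircase a b c r)) ≡⟨ sum-map-replicate-++ largeDemand a 2 _ ⟩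
  a * 2 + sum (map largeDemand (replicate b 3 ++ replicate c 6 ++ r ∷ []))
    ≡⟨ cong (a * 2 +_) (trans (sum-map-replicate-++ largeDemand b 3 _)
                              (cong (b * 1 +_) (sum-map-replicate-++ largeDemand c 6 _))) ⟩
  a * 2 + (b * 1 + (c * 0 + 0))             ≡⟨ simplify a b c ⟩
  a * 2 + b                                 ∎
  where
  open ≡-Reasoning
  simplify : ∀ a b c → a * 2 + (b * 1 + (c * 0 + 0)) ≡ a * 2 + b
  simplify = solve-∀

-- Opened locally: overloading List's _∷_ makes the `solve (u ∷ [])` calls below very slow.
module _ where
  open Linked using ([-]; _∷_)

  replicate-linked : ∀ a {x xs} → Linked _≤_ (x ∷ xs) → Linked _≤_ (x ∷ replicate a x ++ xs)
  replicate-linked zero    linked = linked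
  replicate-linked (suc a) linked = ≤-refl ∷ replicate-linked a linked

  staircase-ascending : ∀ {a b c r} → 1 ≤ a → 1 ≤ b → 1 ≤ c → 6 ≤ r → Linked _≤_ (staircase a b c r)
  staircase-ascending {suc a} {suc b} {suc c} (s≤s _) (s≤s _) (s≤s _) 6≤r =
    replicate-linked a (≤-offset 1 refl ∷
    replicate-linked b (≤-offset 3 refl ∷
    replicate-linked c (6≤r ∷ [-])))

staircase-positive : ∀ a b c r → 6 ≤ r → All (0 <_) (staircase a b c r)
staircase-positive a b c r 6≤r =
  All.++⁺ (replicate⁺ a (s≤s z≤n)) (All.++⁺ (replicate⁺ b (s≤s z≤n))
    (All.++⁺ (replicate⁺ c (s≤s z≤n)) (replicate⁺ 1 (≤-trans (s≤s z≤n) 6≤r))))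

Counterexample : ℕ → ℕ → Set
Counterexample n k = Σ (AscendingPartition n k) λ P → SlackNonneg n k P × ¬ Equitable n k P

record Staircase (n k : ℕ) : Set where
  field
    a b c r mean τ w : ℕ
    a≥1           : 1 ≤ a
    b≥1           : 1 ≤ b
    c≥1           : 1 ≤ c
    r≥6           : 6 ≤ r
    count-parts   : a + b + c + 1 ≡ k
    sum-parts     : a * 2 + b * 3 + c * 6 + r ≡ n
    mean-sum      : 2 * (k * mean) ≡ n * suc n
    fits-2s       : Fits n mean a (a * 2)
    fits-3s       : Fits n mean (a + b) (a * 2 + b * 3)
    fits-6s       : Fits n mean (a + b + c) (a * 2 + b * 3 + c * 6)
    split         : n ≡ τ + 2 + w
    pairs-heavy   : (τ + 2) * 2 + w < mean
    triples-heavy : τ * 3 + 3 < mean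
    few-large     : w < a * 2 + b

staircase-counterexample : ∀ {n k} → Staircase n k → Counterexample n k
staircase-counterexample {n} {k} st =
  P , slack-nonneg P mean-sum prefixes
    , LargeElements.not-equitable τ w split P mean-sum pairs-heavy triples-heavy
        (subst (w <_) (sym (staircase-largeDemand a b c r r≥6)) few-large)
  where
  open Staircase st
  P : AscendingPartition n k
  P = record
    { parts     = staircase a b c r
    ; size      = trans (staircase-length a b c r) count-parts
    ; positive  = staircase-positive a b c r r≥6
    ; ascending = staircase-ascending a≥1 b≥1 c≥1 r≥6
    ; total     = trans (staircase-sum a b c r) sum-parts
    }
  fits-end : Fits n mean (a + b + c + 1) (a * 2 + b * 3 + c * 6 + 1 * r)
  fits-end = subst₂ (Fits n mean) (sym count-parts)
    (sym (trans (cong (a * 2 + b * 3 + c * 6 +_) (*-identityˡ r)) sum-parts)) (fits-total {n} {k} mean-sum)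
  prefixes : PrefixesFit n mean 0 0 (staircase a b c r)
  prefixes =
    prefixesFit-replicate-++ a 2 _ z≤n (
    prefixesFit-replicate-++ b 3 _ fits-2s (
    prefixesFit-replicate-++ c 6 _ fits-3s (
    prefixesFit-replicate-++ 1 r [] fits-6s (
    prefixesFit-[] {n} {mean} fits-end))))

-- In each family w = 2a + b − 1 and τ + 2 = n − w.

staircase-4u+13 : ∀ u → Staircase (3 * (4 * u + 13)) (4 * u + 13)
staircase-4u+13 u = record
  { a = 3 * u + 9 ; b = 2 ; c = u + 1 ; r = 9
  ; mean = 18 * u + 60 ; τ = 6 * u + 18 ; w = 6 * u + 19
  ; a≥1 = ≤-offset (3 * u + 8) (solve (u ∷ []))
  ; b≥1 = s≤s z≤n
  ; c≥1 = ≤-offset u (solve (u ∷ []))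
  ; r≥6 = ≤-offset 3 refl
  ; count-parts = solve (u ∷ [])
  ; sum-parts = solve (u ∷ [])
  ; mean-sum = solve (u ∷ [])
  ; fits-2s = ≤-offset (6 * u + 18) (solve (u ∷ []))
  ; fits-3s = ≤-offset (6 * u) (solve (u ∷ []))
  ; fits-6s = ≤-offset (36 * u + 30) (solve (u ∷ []))
  ; split = solve (u ∷ [])
  ; pairs-heavy = ≤-offset 0 (solve (u ∷ []))
  ; triples-heavy = ≤-offset 2 (solve (u ∷ []))
  ; few-large = ≤-offset 0 (solve (u ∷ []))
  }

staircase-4u+15 : ∀ u → Staircase (3 * (4 * u + 15)) (4 * u + 15)
staircase-4u+15 u = record
  { a = 3 * u + 10 ; b = 3 ; c = u + 1 ; r = 10
  ; mean = 18 * u + 69 ; τ = 6 * u + 21 ; w = 6 * u + 22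
  ; a≥1 = ≤-offset (3 * u + 9) (solve (u ∷ []))
  ; b≥1 = s≤s z≤n
  ; c≥1 = ≤-offset u (solve (u ∷ []))
  ; r≥6 = ≤-offset 4 refl
  ; count-parts = solve (u ∷ [])
  ; sum-parts = solve (u ∷ [])
  ; mean-sum = solve (u ∷ [])
  ; fits-2s = ≤-offset (12 * u + 40) (solve (u ∷ []))
  ; fits-3s = ≤-offset (12 * u + 4) (solve (u ∷ []))
  ; fits-6s = ≤-offset (36 * u + 28) (solve (u ∷ []))
  ; split = solve (u ∷ [])
  ; pairs-heavy = ≤-offset 0 (solve (u ∷ []))
  ; triples-heavy = ≤-offset 2 (solve (u ∷ []))
  ; few-large = ≤-offset 0 (solve (u ∷ []))
  }

staircase-4u+21 : ∀ u → Staircase (12 * u + 62) (4 * u + 21)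
staircase-4u+21 u = record
  { a = 3 * u + 15 ; b = 3 ; c = u + 2 ; r = 11
  ; mean = 18 * u + 93 ; τ = 6 * u + 28 ; w = 6 * u + 32
  ; a≥1 = ≤-offset (3 * u + 14) (solve (u ∷ []))
  ; b≥1 = s≤s z≤n
  ; c≥1 = ≤-offset (u + 1) (solve (u ∷ []))
  ; r≥6 = ≤-offset 5 refl
  ; count-parts = solve (u ∷ [])
  ; sum-parts = solve (u ∷ [])
  ; mean-sum = solve (u ∷ [])
  ; fits-2s = ≤-offset (12 * u + 60) (solve (u ∷ []))
  ; fits-3s = ≤-offset (12 * u + 6) (solve (u ∷ []))
  ; fits-6s = ≤-offset (36 * u + 54) (solve (u ∷ []))
  ; split = solve (u ∷ [])
  ; pairs-heavy = ≤-offset 0 (solve (u ∷ []))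
  ; triples-heavy = ≤-offset 5 (solve (u ∷ []))
  ; few-large = ≤-offset 0 (solve (u ∷ []))
  }

staircase-4u+23 : ∀ u → Staircase (12 * u + 68) (4 * u + 23)
staircase-4u+23 u = record
  { a = 3 * u + 17 ; b = 2 ; c = u + 3 ; r = 10
  ; mean = 18 * u + 102 ; τ = 6 * u + 31 ; w = 6 * u + 35
  ; a≥1 = ≤-offset (3 * u + 16) (solve (u ∷ []))
  ; b≥1 = s≤s z≤n
  ; c≥1 = ≤-offset (u + 2) (solve (u ∷ []))
  ; r≥6 = ≤-offset 4 refl
  ; count-parts = solve (u ∷ [])
  ; sum-parts = solve (u ∷ [])
  ; mean-sum = solve (u ∷ [])
  ; fits-2s = ≤-offset (6 * u + 34) (solve (u ∷ []))
  ; fits-3s = ≤-offset (6 * u + 4) (solve (u ∷ []))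
  ; fits-6s = ≤-offset (36 * u + 94) (solve (u ∷ []))
  ; split = solve (u ∷ [])
  ; pairs-heavy = ≤-offset 0 (solve (u ∷ []))
  ; triples-heavy = ≤-offset 5 (solve (u ∷ []))
  ; few-large = ≤-offset 0 (solve (u ∷ []))
  }

even-or-odd : ∀ m → (∃ λ u → m ≡ 2 * u) ⊎ (∃ λ u → m ≡ 1 + 2 * u)
even-or-odd zero = inj₁ (0 , refl)
even-or-odd (suc m) with even-or-odd m
... | inj₁ (u , refl) = inj₂ (u , refl)
... | inj₂ (u , refl) = inj₁ (suc u , solve (u ∷ []))

odd-≥-mod-4 : ∀ {b k} → Odd b → Odd k → b ≤ k →
              (∃ λ u → k ≡ 4 * u + b) ⊎ (∃ λ u → k ≡ 4 * u + (2 + b))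
odd-≥-mod-4 (s , refl) (t , refl) (s≤s 2s≤2t) with t ∸ s | m+[n∸m]≡n (*-cancelˡ-≤ {s} {t} 2 2s≤2t)
... | d | refl with even-or-odd d
...   | inj₁ (u , refl) = inj₁ (u , solve (s ∷ u ∷ []))
...   | inj₂ (u , refl) = inj₂ (u , solve (s ∷ u ∷ []))

counterexample-∸1 : ∀ {m k} t → Counterexample m k → suc m ≡ t → Counterexample (t ∸ 1) k
counterexample-∸1 t ce refl = ce

corollary6p2 :
    ((k : ℕ) → Odd k → 13 ≤ k →
      Σ (AscendingPartition (3 * k) k) λ P →
        SlackNonneg (3 * k) k P × ¬ Equitable (3 * k) k P)
    ×
    ((k : ℕ) → Odd k → 21 ≤ k →
      Σ (AscendingPartition (3 * k ∸ 1) k) λ P →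
        SlackNonneg (3 * k ∸ 1) k P × ¬ Equitable (3 * k ∸ 1) k P)
corollary6p2 = case-3k , case-3k∸1
  where
  case-3k : ∀ k → Odd k → 13 ≤ k → Counterexample (3 * k) k
  case-3k k odd 13≤k with odd-≥-mod-4 (6 , refl) odd 13≤k
  ... | inj₁ (u , refl) = staircase-counterexample (staircase-4u+13 u)
  ... | inj₂ (u , refl) = staircase-counterexample (staircase-4u+15 u)

  case-3k∸1 : ∀ k → Odd k → 21 ≤ k → Counterexample (3 * k ∸ 1) k
  case-3k∸1 k odd 21≤k with odd-≥-mod-4 (10 , refl) odd 21≤k
  ... | inj₁ (u , refl) =
    counterexample-∸1 (3 * k) (staircase-counterexample (staircase-4u+21 u)) (solve (u ∷ []))
  ... | inj₂ (u , refl) =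
    counterexample-∸1 (3 * k) (staircase-counterexample (staircase-4u+23 u)) (solve (u ∷ []))
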